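{- Let $K$ be a finite simplicial complex and $\overrightarrow{W}$ a Morse sequence on $K$ with Morse reference $\Upsilon$. Then the maps $d_p$ are boundary operators, that is, $d_p\circ d_{p+1}=0$ for every $p\ge 0$.
   Context: A finite simplicial complex $K$ is a finite family of non-empty finite sets such that $\sigma\in K$ whenever $\emptyset\neq\sigma\subseteq\tau$ for some $\tau\in K$; $K^{(p)}$ is the set of $p$-simplexes (sets of $p+1$ elements), and a facet is an inclusion-maximal simplex. For $p\ge -1$, $K[p]$ is the set of all subsets of $K^{(p)}$ (with $K^{(-1)}=\emptyset$), a $\mathbb{Z}_2$-vector space under symmetric difference, the empty chain being $0$. For $\sigma\in K^{(p)}$, $\partial(\sigma)=\{\tau\in K^{(p-1)}:\tau\subset\sigma\}$; $\partial_p:K[p]\to K[p-1]$ is $\partial_p(c)=\sum_{\sigma\in c}\partial(\sigma)$ (mod 2), $\partial_p(\emptyset)=0$. A pair $(\sigma,\tau)$ with $\sigma\in K^{(p)},\tau\in K^{(p+1)}$ is free for $K$ if $\tau$ is the only simplex of $K$ strictly containing $\sigma$; then $K$ is an elementary expansion of $K\setminus\{\sigma,\tau\}$. If $\sigma$ is a facet of $K$, $K$ is an elementary filling of $K\setminus\{\sigma\}$. A Morse sequence on $K$ is a sequence $\langle\emptyset=K_0,\dots,K_k=K\rangle$ where each $K_i$ is an elementary expansion or elementary filling of $K_{i-1}$; a simplex added by a filling is critical, and a free pair $(\sigma,\tau)$ added by an expansion is a regular pair. $\ddot{W}^{(p)}$ is the set of critical $p$-simplexes ($\ddot{W}^{(-1)}=\emptyset$)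 and $\ddot{W}[p]$ the set of its subsets. A Morse frame is a map $\Upsilon$ sending each $\sigma\in K^{(p)}$ to $\Upsilon(\sigma)\in\ddot{W}[p]$, extended to chains by $\Upsilon(c)=\sum_{\sigma\in c}\Upsilon(\sigma)$ (mod 2), $\Upsilon(\emptyset)=0$. The Morse reference $\Upsilon$ is the unique frame with $\Upsilon(\sigma)=\{\sigma\}$ for critical $\sigma$ and, for each regular pair $(\sigma,\tau)$, $\Upsilon(\tau)=0$ and $\Upsilon(\sigma)=\Upsilon(\partial(\tau)\setminus\{\sigma\})$. For a critical $p$-simplex $\sigma$, set $d(\sigma)=\Upsilon(\partial(\sigma))$, and define $d_p:\ddot{W}[p]\to\ddot{W}[p-1]$ by $d_p(c)=\Upsilon(\partial_p(c))=\sum_{\sigma\in c}d(\sigma)$, $d_p(\emptyset)=0$. -}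

module Defs where

open import Data.Nat using (ℕ; zero; suc; _+_; _≡ᵇ_)
open import Data.Bool using (Bool; true; false; _∧_; not; _xor_)
import Data.Bool as Bool
open import Data.Vec using (_∷_; [])
open import Data.Vec.Properties using (≡-dec)
open import Data.Fin.Subset using (Subset; _⊆_; ∣_∣; Nonempty; inside; outside)
open import Data.Fin.Subset.Properties using (_⊆?_)
open import Data.List using (List; []; _∷_; _++_; [_]; foldr; map; concatMap)
open import Data.List.Membership.Propositional using (_∈_; _∉_)
import Data.List.Membership.DecPropositional as DecMem
open import Data.Product using (_×_; Σ)
open import Data.Unit using (⊤)
open import Relation.Nullary using (¬_; Dec)
open import Relation.Nullary.Decidable using (⌊_⌋)
open import Relation.Binary.PropositionalEquality using (_≡_; _≢_)
open import Relation.Binary using (DecidableEquality)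
open import Function.Bundles using (_⇔_)

-- Simplexes on the vertex set Fin n are subsets of Fin n.
-- A p-simplex is a simplex with p+1 vertices.

_≟ₛ_ : ∀ {n} → DecidableEquality (Subset n)
_≟ₛ_ = ≡-dec Bool._≟_

IsDim : ∀ {n} → ℕ → Subset n → Set
IsDim p σ = ∣ σ ∣ ≡ suc p

-- A finite family of simplexes is given by a list (read as a set).
-- Finite simplicial complex.
record IsComplex {n : ℕ} (K : List (Subset n)) : Set where
  field
    nonempty : ∀ {σ} → σ ∈ K → Nonempty σ
    closed   : ∀ {σ τ} → τ ∈ K → Nonempty σ → σ ⊆ τ → σ ∈ K

_⊊_ : ∀ {n} → Subset n → Subset n → Set
σ ⊊ τ = σ ⊆ τ × σ ≢ τ

record IsFreePair {n : ℕ} (K : List (Subset n)) (σ τ : Subset n) : Set where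
  field
    p      : ℕ
    σ∈K    : σ ∈ K
    τ∈K    : τ ∈ K
    dimσ   : IsDim p σ
    dimτ   : IsDim (suc p) τ
    σ⊊τ    : σ ⊊ τ
    unique : ∀ {ν} → ν ∈ K → σ ⊊ ν → ν ≡ τ

record IsFacet {n : ℕ} (K : List (Subset n)) (σ : Subset n) : Set where
  field
    σ∈K   : σ ∈ K
    maxim : ∀ {ν} → ν ∈ K → σ ⊆ ν → ν ≡ σ

data Step (n : ℕ) : Set where
  fill   : Subset n → Step n
  expand : Subset n → Subset n → Step n

added : ∀ {n} → Step n → List (Subset n)
added (fill σ)     = [ σ ]
added (expand σ τ) = σ ∷ τ ∷ []

ValidStep : ∀ {n} → List (Subset n) → Step n → Set
ValidStep L (fill σ) =
  IsComplex (L ++ [ σ ]) × IsFacet (L ++ [ σ ]) σ × σ ∉ L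
ValidStep L (expand σ τ) =
  IsComplex (L ++ σ ∷ τ ∷ []) × IsFreePair (L ++ σ ∷ τ ∷ []) σ τ × σ ∉ L × τ ∉ L

ValidFrom : ∀ {n} → List (Subset n) → List (Step n) → Set
ValidFrom L []       = ⊤
ValidFrom L (s ∷ W) = ValidStep L s × ValidFrom (L ++ added s) W

final : ∀ {n} → List (Step n) → List (Subset n)
final W = concatMap added W

IsMorseSequence : ∀ {n} → List (Subset n) → List (Step n) → Set
IsMorseSequence {n} K W = ValidFrom [] W × (∀ (σ : Subset n) → (σ ∈ K) ⇔ (σ ∈ final W))

Critical : ∀ {n} → List (Step n) → Subset n → Set
Critical W σ = fill σ ∈ W

RegularPair : ∀ {n} → List (Step n) → Subset n → Subset n → Set
RegularPair W σ τ = expand σ τ ∈ W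

-- ℤ₂-chains: a chain is (the indicator function of) a finite set of
-- simplexes; addition is symmetric difference (pointwise xor).

Chain : ℕ → Set
Chain n = Subset n → Bool

0ᶜ : ∀ {n} → Chain n
0ᶜ _ = false

⟦_⟧ : ∀ {n} → Subset n → Chain n
⟦ σ ⟧ x = ⌊ x ≟ₛ σ ⌋

allSubsets : (n : ℕ) → List (Subset n)
allSubsets zero    = [] ∷ []
allSubsets (suc n) = map (inside ∷_) (allSubsets n) ++ map (outside ∷_) (allSubsets n)

ext : ∀ {n} → (Subset n → Chain n) → Chain n → Chain n
ext {n} f c x = foldr (λ σ acc → (c σ ∧ f σ x) xor acc) false (allSubsets n)

IsChainOf : ∀ {n} → List (Subset n) → ℕ → Chain n → Set
IsChainOf K p c = ∀ x → c x ≡ true → x ∈ K × IsDim p x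

IsCriticalChain : ∀ {n} → List (Step n) → ℕ → Chain n → Set
IsCriticalChain W p c = ∀ x → c x ≡ true → Critical W x × IsDim p x

∂ : ∀ {n} → List (Subset n) → Subset n → Chain n
∂ K σ τ = ⌊ DecMem._∈?_ _≟ₛ_ τ K ⌋ ∧ ⌊ τ ⊆? σ ⌋ ∧ (suc ∣ τ ∣ ≡ᵇ ∣ σ ∣)

∂ᶜ : ∀ {n} → List (Subset n) → Chain n → Chain n
∂ᶜ K = ext (∂ K)

∂without : ∀ {n} → List (Subset n) → Subset n → Subset n → Chain n
∂without K τ σ x = ∂ K τ x ∧ not ⌊ x ≟ₛ σ ⌋

_≗ᶜ_ : ∀ {n} → Chain n → Chain n → Set
c ≗ᶜ c' = ∀ x → c x ≡ c' x

IsMorseFrame : ∀ {n} → List (Subset n) → List (Step n) → (Subset n → Chain n) → Set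
IsMorseFrame K W Υ = ∀ p σ → σ ∈ K → IsDim p σ → IsCriticalChain W p (Υ σ)

record IsMorseReference {n : ℕ} (K : List (Subset n)) (W : List (Step n))
                        (Υ : Subset n → Chain n) : Set where
  field
    frame    : IsMorseFrame K W Υ
    critical : ∀ σ → Critical W σ → Υ σ ≗ᶜ ⟦ σ ⟧
    regularτ : ∀ σ τ → RegularPair W σ τ → Υ τ ≗ᶜ 0ᶜ
    regularσ : ∀ σ τ → RegularPair W σ τ → Υ σ ≗ᶜ ext Υ (∂without K τ σ)

dᶜ : ∀ {n} → List (Subset n) → (Subset n → Chain n) → Chain n → Chain n
dᶜ K Υ c = ext Υ (∂ᶜ K c)

{-# OPTIONS --safe #-}

-- The Morse reference Υ is a chain map: d (Υ σ) = Υ (∂ σ) for every simplex σ of K, where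
-- d (Υ σ) = Υ (∂ (Υ σ)). This holds along the Morse sequence. For a critical σ, Υ σ = σ.
-- For a regular pair (σ , τ), Υ τ = 0 and Υ σ = Υ (∂τ ∖ σ) = Υ σ + Υ (∂ τ) force Υ (∂ τ) = 0,
-- so both sides vanish at τ; at σ, linearity reduces the claim to the simplexes of ∂τ ∖ σ,
-- which come earlier in the sequence, and ∂ (∂τ ∖ σ) = ∂ σ + ∂ ∂ τ = ∂ σ.
-- Hence d (d c) = d (Υ (∂ c)) = Υ (∂ ∂ c) = 0. Over ℤ₂, ∂ ∂ = 0 because a codimension-two face
-- of a simplex lies in exactly two of its facets, and (2 choose 1) is even.
module Submission where

open import Defs
open import Data.Nat using (ℕ; zero; suc; _+_; _≡ᵇ_; _≟_; s≤s)
open import Data.Nat.Properties using (+-suc; +-cancelʳ-≡; <⇒≢; n<1+n; ≡ᵇ⇒≡)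
open import Data.Bool using (Bool; true; false; _∧_; _xor_; not)
open import Data.Bool.Properties
  using ( ∧-assoc; ∧-zeroʳ; ∧-identityʳ; ∧-distribˡ-xor; ∧-distribʳ-xor
        ; xor-assoc; xor-identityʳ; xor-∧-commutativeRing; T-≡ )
open import Data.Vec using (_∷_; [])
import Data.Vec as Vec
open import Data.Fin.Subset using (Subset; inside; outside; _⊆_; _─_; ∣_∣)
open import Data.Fin.Subset.Properties using (_⊆?_; drop-∷-⊆; p⊆q⇒∣p∣≤∣q∣)
open import Data.List using (List; []; _∷_; _++_; map; foldr)
open import Data.List.Properties using (foldr-map; ++-assoc; ++-identityʳ)
open import Data.List.Membership.Propositional using (_∈_; lose)
open import Data.List.Membership.Propositional.Properties using (∈-++⁻; ∈-concatMap⁺)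
import Data.List.Membership.DecPropositional as DecMembership
open import Data.List.Relation.Unary.Any using (here; there)
import Data.List.Relation.Binary.Subset.Propositional as List
open import Data.List.Relation.Binary.Subset.Propositional.Properties using (xs⊆xs++ys; ⊆-reflexive)
open import Data.Product using (_×_; _,_; proj₁; proj₂)
open import Data.Sum using (inj₁; inj₂)
open import Function using (_∘_)
open import Function.Bundles using (Equivalence)
open import Relation.Nullary using (Dec; yes; no; ¬_; contradiction)
open import Relation.Nullary.Decidable
  using (⌊_⌋; isYes≗does; ⌊⌋-map′; dec-true; dec-false; decidable-stable)
open import Relation.Binary.PropositionalEquality
  using (_≡_; _≢_; refl; sym; trans; cong; cong₂; subst; module ≡-Reasoning)
open import Algebra.Bundles using (CommutativeRing)
open import Algebra.Properties.CommutativeSemigroup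
  (CommutativeRing.+-commutativeSemigroup xor-∧-commutativeRing) using (interchange)
open import Algebra.Properties.Group
  (CommutativeRing.+-group xor-∧-commutativeRing) using (identityʳ-unique)

open ≡-Reasoning

⌊⌋-true : {A : Set} (a? : Dec A) → A → ⌊ a? ⌋ ≡ true
⌊⌋-true a? a = trans (isYes≗does a?) (dec-true a? a)

⌊⌋-false : {A : Set} (a? : Dec A) → ¬ A → ⌊ a? ⌋ ≡ false
⌊⌋-false a? ¬a = trans (isYes≗does a?) (dec-false a? ¬a)

≡ᵇ-false : ∀ {l m} → l ≢ m → (l ≡ᵇ m) ≡ false
≡ᵇ-false {l} {m} = dec-false (l ≟ m)

≡ᵇ-subst : ∀ (P : ℕ → Bool) l m → P m ∧ (l ≡ᵇ m) ≡ P l ∧ (l ≡ᵇ m)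
≡ᵇ-subst P l m with l ≟ m
... | yes refl = refl
... | no  l≢m  rewrite ≡ᵇ-false l≢m | ∧-zeroʳ (P m) | ∧-zeroʳ (P l) = refl

⊆?-outside : ∀ {n} b (p q : Subset n) → ⌊ (outside ∷ p) ⊆? (b ∷ q) ⌋ ≡ ⌊ p ⊆? q ⌋
⊆?-outside b p q = ⌊⌋-map′ _ _ (p ⊆? q)

⊆?-inside : ∀ {n} (p q : Subset n) → ⌊ (inside ∷ p) ⊆? (inside ∷ q) ⌋ ≡ ⌊ p ⊆? q ⌋
⊆?-inside p q = ⌊⌋-map′ _ _ (p ⊆? q)

-- does, unlike ⌊_⌋ = isYes, computes through map′ and _×-dec_ once the head bits are known.
≟ₛ-∷ : ∀ {n} b (p q : Subset n) → ⌊ (b ∷ p) ≟ₛ (b ∷ q) ⌋ ≡ ⌊ p ≟ₛ q ⌋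
≟ₛ-∷ inside  p q = trans (isYes≗does _) (sym (isYes≗does (p ≟ₛ q)))
≟ₛ-∷ outside p q = trans (isYes≗does _) (sym (isYes≗does (p ≟ₛ q)))

∣p∣≡∣p─q∣+∣q∣ : ∀ {n} {p q : Subset n} → q ⊆ p → ∣ p ∣ ≡ ∣ p ─ q ∣ + ∣ q ∣
∣p∣≡∣p─q∣+∣q∣ {p = []}          {[]}          _   = refl
∣p∣≡∣p─q∣+∣q∣ {p = inside ∷ p}  {inside ∷ q}  q⊆p =
  trans (cong suc (∣p∣≡∣p─q∣+∣q∣ (drop-∷-⊆ q⊆p))) (sym (+-suc ∣ p ─ q ∣ ∣ q ∣))
∣p∣≡∣p─q∣+∣q∣ {p = inside ∷ p}  {outside ∷ q} q⊆p = cong suc (∣p∣≡∣p─q∣+∣q∣ (drop-∷-⊆ q⊆p))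
∣p∣≡∣p─q∣+∣q∣ {p = outside ∷ p} {outside ∷ q} q⊆p = ∣p∣≡∣p─q∣+∣q∣ (drop-∷-⊆ q⊆p)
∣p∣≡∣p─q∣+∣q∣ {p = outside ∷ p} {inside ∷ q}  q⊆p = contradiction (q⊆p Vec.here) λ ()

-- ext f c x is definitionally xorSum (allSubsets n) (λ σ → c σ ∧ f σ x).
xorSum : {A : Set} → List A → (A → Bool) → Bool
xorSum xs h = foldr (λ x acc → h x xor acc) false xs

module _ {A : Set} where

  xorSum-cong : ∀ xs {g h : A → Bool} → (∀ x → g x ≡ h x) → xorSum xs g ≡ xorSum xs h
  xorSum-cong []       g≗h = refl
  xorSum-cong (x ∷ xs) g≗h = cong₂ _xor_ (g≗h x) (xorSum-cong xs g≗h)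

  xorSum-false : ∀ (xs : List A) → xorSum xs (λ _ → false) ≡ false
  xorSum-false []       = refl
  xorSum-false (x ∷ xs) = xorSum-false xs

  xorSum-xor : ∀ xs (g h : A → Bool) → xorSum xs (λ x → g x xor h x) ≡ xorSum xs g xor xorSum xs h
  xorSum-xor []       g h = refl
  xorSum-xor (x ∷ xs) g h =
    trans (cong ((g x xor h x) xor_) (xorSum-xor xs g h)) (interchange (g x) (h x) _ _)

  xorSum-∧ˡ : ∀ xs b (h : A → Bool) → b ∧ xorSum xs h ≡ xorSum xs (λ x → b ∧ h x)
  xorSum-∧ˡ []       b h = ∧-zeroʳ b
  xorSum-∧ˡ (x ∷ xs) b h =
    trans (∧-distribˡ-xor b (h x) _) (cong ((b ∧ h x) xor_) (xorSum-∧ˡ xs b h))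

  xorSum-∧ʳ : ∀ xs b (h : A → Bool) → xorSum xs h ∧ b ≡ xorSum xs (λ x → h x ∧ b)
  xorSum-∧ʳ []       b h = refl
  xorSum-∧ʳ (x ∷ xs) b h =
    trans (∧-distribʳ-xor b (h x) _) (cong ((h x ∧ b) xor_) (xorSum-∧ʳ xs b h))

  xorSum-++ : ∀ xs ys (h : A → Bool) → xorSum (xs ++ ys) h ≡ xorSum xs h xor xorSum ys h
  xorSum-++ []       ys h = refl
  xorSum-++ (x ∷ xs) ys h = trans (cong (h x xor_) (xorSum-++ xs ys h)) (sym (xor-assoc (h x) _ _))

xorSum-swap : ∀ {A B : Set} xs ys (h : A → B → Bool) →
  xorSum xs (λ x → xorSum ys (h x)) ≡ xorSum ys (λ y → xorSum xs (λ x → h x y))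
xorSum-swap []       ys h = sym (xorSum-false ys)
xorSum-swap (x ∷ xs) ys h =
  trans (cong (xorSum ys (h x) xor_) (xorSum-swap xs ys h)) (sym (xorSum-xor ys (h x) _))

xorSum-allSubsets : ∀ n (h : Subset (suc n) → Bool) (h₁ h₀ : Subset n → Bool) →
  (∀ s → h (inside ∷ s) ≡ h₁ s) → (∀ s → h (outside ∷ s) ≡ h₀ s) →
  xorSum (allSubsets (suc n)) h ≡ xorSum (allSubsets n) h₁ xor xorSum (allSubsets n) h₀
xorSum-allSubsets n h h₁ h₀ eq₁ eq₀ = begin
  xorSum (map (inside ∷_) S ++ map (outside ∷_) S) h
    ≡⟨ xorSum-++ (map (inside ∷_) S) (map (outside ∷_) S) h ⟩
  xorSum (map (inside ∷_) S) h xor xorSum (map (outside ∷_) S) h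
    ≡⟨ cong₂ _xor_ (foldr-map _ (inside ∷_) false S) (foldr-map _ (outside ∷_) false S) ⟩
  xorSum S (h ∘ (inside ∷_)) xor xorSum S (h ∘ (outside ∷_))
    ≡⟨ cong₂ _xor_ (xorSum-cong S eq₁) (xorSum-cong S eq₀) ⟩
  xorSum S h₁ xor xorSum S h₀ ∎
  where S = allSubsets n

xorSum-δ : ∀ n (v : Subset n) (h : Subset n → Bool) →
  xorSum (allSubsets n) (λ s → ⌊ s ≟ₛ v ⌋ ∧ h s) ≡ h v
xorSum-δ zero    []            h = xor-identityʳ (h [])
xorSum-δ (suc n) (inside ∷ v)  h = begin
  xorSum (allSubsets (suc n)) (λ s → ⌊ s ≟ₛ (inside ∷ v) ⌋ ∧ h s)
    ≡⟨ xorSum-allSubsets n (λ s → ⌊ s ≟ₛ (inside ∷ v) ⌋ ∧ h s)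
         (λ s → ⌊ s ≟ₛ v ⌋ ∧ h (inside ∷ s)) (λ _ → false)
         (λ s → cong (_∧ h (inside ∷ s)) (≟ₛ-∷ inside s v)) (λ _ → refl) ⟩
  xorSum (allSubsets n) (λ s → ⌊ s ≟ₛ v ⌋ ∧ h (inside ∷ s)) xor xorSum (allSubsets n) (λ _ → false)
    ≡⟨ cong₂ _xor_ (xorSum-δ n v (h ∘ (inside ∷_))) (xorSum-false (allSubsets n)) ⟩
  h (inside ∷ v) xor false
    ≡⟨ xor-identityʳ _ ⟩
  h (inside ∷ v) ∎
xorSum-δ (suc n) (outside ∷ v) h = begin
  xorSum (allSubsets (suc n)) (λ s → ⌊ s ≟ₛ (outside ∷ v) ⌋ ∧ h s)
    ≡⟨ xorSum-allSubsets n (λ s → ⌊ s ≟ₛ (outside ∷ v) ⌋ ∧ h s)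
         (λ _ → false) (λ s → ⌊ s ≟ₛ v ⌋ ∧ h (outside ∷ s))
         (λ _ → refl) (λ s → cong (_∧ h (outside ∷ s)) (≟ₛ-∷ outside s v)) ⟩
  xorSum (allSubsets n) (λ _ → false) xor xorSum (allSubsets n) (λ s → ⌊ s ≟ₛ v ⌋ ∧ h (outside ∷ s))
    ≡⟨ cong₂ _xor_ (xorSum-false (allSubsets n)) (xorSum-δ n v (h ∘ (outside ∷_))) ⟩
  h (outside ∷ v) ∎

module _ {n : ℕ} where
  private
    S : List (Subset n)
    S = allSubsets n

  ext-cong : ∀ (f : Subset n → Chain n) {c c' : Chain n} → c ≗ᶜ c' → ext f c ≗ᶜ ext f c'
  ext-cong f c≗c' x = xorSum-cong S λ σ → cong (_∧ f σ x) (c≗c' σ)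

  ext-cong-support : ∀ (f g : Subset n → Chain n) (c : Chain n) x →
    (∀ σ → c σ ≡ true → f σ x ≡ g σ x) → ext f c x ≡ ext g c x
  ext-cong-support f g c x f≈g = xorSum-cong S agree
    where
    agree : ∀ σ → c σ ∧ f σ x ≡ c σ ∧ g σ x
    agree σ with c σ in cσ
    ... | true  = f≈g σ cσ
    ... | false = refl

  ext-vanishes : ∀ (f : Subset n → Chain n) (c : Chain n) x →
    (∀ σ → c σ ≡ true → f σ x ≡ false) → ext f c x ≡ false
  ext-vanishes f c x f≈0 = begin
    ext f c x                      ≡⟨ ext-cong-support f (λ _ _ → false) c x f≈0 ⟩
    xorSum S (λ σ → c σ ∧ false)   ≡⟨ xorSum-cong S (∧-zeroʳ ∘ c) ⟩
    xorSum S (λ _ → false)         ≡⟨ xorSum-false S ⟩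
    false                          ∎

  ext-xor : ∀ (f : Subset n → Chain n) (c c' : Chain n) x →
    ext f (λ σ → c σ xor c' σ) x ≡ ext f c x xor ext f c' x
  ext-xor f c c' x =
    trans (xorSum-cong S λ σ → ∧-distribʳ-xor (f σ x) (c σ) (c' σ))
          (xorSum-xor S (λ σ → c σ ∧ f σ x) (λ σ → c' σ ∧ f σ x))

  ext-⟦⟧ : ∀ (f : Subset n → Chain n) σ → ext f ⟦ σ ⟧ ≗ᶜ f σ
  ext-⟦⟧ f σ x = xorSum-δ n σ (λ τ → f τ x)

  ext-0ᶜ : ∀ (f : Subset n → Chain n) → ext f 0ᶜ ≗ᶜ 0ᶜ
  ext-0ᶜ f x = xorSum-false S

  ext-ext : ∀ (f g : Subset n → Chain n) (c : Chain n) → ext f (ext g c) ≗ᶜ ext (λ σ → ext f (g σ)) c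
  ext-ext f g c x = begin
    xorSum S (λ τ → xorSum S (λ σ → c σ ∧ g σ τ) ∧ f τ x)
      ≡⟨ xorSum-cong S (λ τ → xorSum-∧ʳ S (f τ x) (λ σ → c σ ∧ g σ τ)) ⟩
    xorSum S (λ τ → xorSum S (λ σ → (c σ ∧ g σ τ) ∧ f τ x))
      ≡⟨ xorSum-swap S S (λ τ σ → (c σ ∧ g σ τ) ∧ f τ x) ⟩
    xorSum S (λ σ → xorSum S (λ τ → (c σ ∧ g σ τ) ∧ f τ x))
      ≡⟨ xorSum-cong S (λ σ → trans (xorSum-cong S λ τ → ∧-assoc (c σ) (g σ τ) (f τ x))
                                    (sym (xorSum-∧ˡ S (c σ) (λ τ → g σ τ ∧ f τ x)))) ⟩
    xorSum S (λ σ → c σ ∧ xorSum S (λ τ → g σ τ ∧ f τ x)) ∎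

  delete≗⟦⟧-xor : ∀ (c : Chain n) σ → c σ ≡ true → ∀ y → c y ∧ not ⌊ y ≟ₛ σ ⌋ ≡ ⌊ y ≟ₛ σ ⌋ xor c y
  delete≗⟦⟧-xor c σ cσ y with y ≟ₛ σ
  ... | yes refl rewrite cσ = refl
  ... | no  _    = ∧-identityʳ (c y)

oddBinomial : ℕ → ℕ → Bool
oddBinomial _       zero    = true
oddBinomial zero    (suc k) = false
oddBinomial (suc m) (suc k) = oddBinomial m k xor oddBinomial m (suc k)

inInterval : ∀ {n} → Subset n → Subset n → ℕ → Subset n → Bool
inInterval x σ k τ = (⌊ x ⊆? τ ⌋ ∧ ⌊ τ ⊆? σ ⌋) ∧ (k + ∣ x ∣ ≡ᵇ ∣ τ ∣)

intervalParity : ∀ {n} → Subset n → Subset n → ℕ → Bool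
intervalParity {n} x σ k = xorSum (allSubsets n) (inInterval x σ k)

module _ {n : ℕ} (x σ : Subset n) where

  inInterval-outside : ∀ b k τ → inInterval (outside ∷ x) (b ∷ σ) k (outside ∷ τ) ≡ inInterval x σ k τ
  inInterval-outside b k τ =
    cong₂ (λ p q → (p ∧ q) ∧ (k + ∣ x ∣ ≡ᵇ ∣ τ ∣)) (⊆?-outside outside x τ) (⊆?-outside b τ σ)

  inInterval-inside : ∀ k τ → inInterval (inside ∷ x) (inside ∷ σ) k (inside ∷ τ) ≡ inInterval x σ k τ
  inInterval-inside k τ =
    cong₂ _∧_ (cong₂ _∧_ (⊆?-inside x τ) (⊆?-inside τ σ)) (cong (_≡ᵇ suc ∣ τ ∣) (+-suc k ∣ x ∣))

  inInterval-new-vertex : ∀ k τ →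
    inInterval (outside ∷ x) (inside ∷ σ) (suc k) (inside ∷ τ) ≡ inInterval x σ k τ
  inInterval-new-vertex k τ =
    cong₂ (λ p q → (p ∧ q) ∧ (k + ∣ x ∣ ≡ᵇ ∣ τ ∣)) (⊆?-outside inside x τ) (⊆?-inside τ σ)

  inInterval-rank-zero : ∀ τ → inInterval (outside ∷ x) (inside ∷ σ) 0 (inside ∷ τ) ≡ false
  inInterval-rank-zero τ =
    trans (cong₂ (λ p q → (p ∧ q) ∧ (∣ x ∣ ≡ᵇ suc ∣ τ ∣)) (⊆?-outside inside x τ) (⊆?-inside τ σ))
          (too-small (x ⊆? τ))
    where
    too-small : (x⊆?τ : Dec (x ⊆ τ)) → (⌊ x⊆?τ ⌋ ∧ ⌊ τ ⊆? σ ⌋) ∧ (∣ x ∣ ≡ᵇ suc ∣ τ ∣) ≡ false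
    too-small (no  _)   = refl
    too-small (yes x⊆τ) =
      trans (cong (⌊ τ ⊆? σ ⌋ ∧_) (≡ᵇ-false (<⇒≢ (s≤s (p⊆q⇒∣p∣≤∣q∣ x⊆τ))))) (∧-zeroʳ _)

  inInterval-outside-top : ∀ b k τ → inInterval (b ∷ x) (outside ∷ σ) k (inside ∷ τ) ≡ false
  inInterval-outside-top b k τ =
    cong (_∧ (k + ∣ b ∷ x ∣ ≡ᵇ suc ∣ τ ∣)) (∧-zeroʳ ⌊ (b ∷ x) ⊆? (inside ∷ τ) ⌋)

intervalParity-binomial : ∀ {n} (x σ : Subset n) k →
  intervalParity x σ k ≡ ⌊ x ⊆? σ ⌋ ∧ oddBinomial ∣ σ ─ x ∣ k
intervalParity-binomial []            []            zero    = refl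
intervalParity-binomial []            []            (suc k) = refl
intervalParity-binomial {suc n} (outside ∷ x) (outside ∷ σ) k = begin
  intervalParity (outside ∷ x) (outside ∷ σ) k
    ≡⟨ xorSum-allSubsets n (inInterval (outside ∷ x) (outside ∷ σ) k) (λ _ → false) (inInterval x σ k)
         (inInterval-outside-top x σ outside k) (inInterval-outside x σ outside k) ⟩
  xorSum (allSubsets n) (λ _ → false) xor intervalParity x σ k
    ≡⟨ cong₂ _xor_ (xorSum-false (allSubsets n)) (intervalParity-binomial x σ k) ⟩
  ⌊ x ⊆? σ ⌋ ∧ oddBinomial d k
    ≡⟨ cong (_∧ oddBinomial d k) (sym (⊆?-outside outside x σ)) ⟩
  ⌊ (outside ∷ x) ⊆? (outside ∷ σ) ⌋ ∧ oddBinomial d k ∎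
  where d = ∣ σ ─ x ∣
intervalParity-binomial {suc n} (outside ∷ x) (inside ∷ σ) zero = begin
  intervalParity (outside ∷ x) (inside ∷ σ) 0
    ≡⟨ xorSum-allSubsets n (inInterval (outside ∷ x) (inside ∷ σ) 0) (λ _ → false) (inInterval x σ 0)
         (inInterval-rank-zero x σ) (inInterval-outside x σ inside 0) ⟩
  xorSum (allSubsets n) (λ _ → false) xor intervalParity x σ 0
    ≡⟨ cong₂ _xor_ (xorSum-false (allSubsets n)) (intervalParity-binomial x σ 0) ⟩
  ⌊ x ⊆? σ ⌋ ∧ true
    ≡⟨ cong (_∧ true) (sym (⊆?-outside inside x σ)) ⟩
  ⌊ (outside ∷ x) ⊆? (inside ∷ σ) ⌋ ∧ true ∎
intervalParity-binomial {suc n} (outside ∷ x) (inside ∷ σ) (suc k) = begin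
  intervalParity (outside ∷ x) (inside ∷ σ) (suc k)
    ≡⟨ xorSum-allSubsets n (inInterval (outside ∷ x) (inside ∷ σ) (suc k))
         (inInterval x σ k) (inInterval x σ (suc k))
         (inInterval-new-vertex x σ k) (inInterval-outside x σ inside (suc k)) ⟩
  intervalParity x σ k xor intervalParity x σ (suc k)
    ≡⟨ cong₂ _xor_ (intervalParity-binomial x σ k) (intervalParity-binomial x σ (suc k)) ⟩
  (⌊ x ⊆? σ ⌋ ∧ oddBinomial d k) xor (⌊ x ⊆? σ ⌋ ∧ oddBinomial d (suc k))
    ≡⟨ sym (∧-distribˡ-xor ⌊ x ⊆? σ ⌋ (oddBinomial d k) (oddBinomial d (suc k))) ⟩
  ⌊ x ⊆? σ ⌋ ∧ oddBinomial (suc d) (suc k)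
    ≡⟨ cong (_∧ oddBinomial (suc d) (suc k)) (sym (⊆?-outside inside x σ)) ⟩
  ⌊ (outside ∷ x) ⊆? (inside ∷ σ) ⌋ ∧ oddBinomial (suc d) (suc k) ∎
  where d = ∣ σ ─ x ∣
intervalParity-binomial {suc n} (inside ∷ x) (outside ∷ σ) k =
  trans (xorSum-allSubsets n (inInterval (inside ∷ x) (outside ∷ σ) k) (λ _ → false) (λ _ → false)
           (inInterval-outside-top x σ inside k) (λ _ → refl))
        (cong₂ _xor_ (xorSum-false (allSubsets n)) (xorSum-false (allSubsets n)))
intervalParity-binomial {suc n} (inside ∷ x) (inside ∷ σ) k = begin
  intervalParity (inside ∷ x) (inside ∷ σ) k
    ≡⟨ xorSum-allSubsets n (inInterval (inside ∷ x) (inside ∷ σ) k) (inInterval x σ k) (λ _ → false)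
         (inInterval-inside x σ k) (λ _ → refl) ⟩
  intervalParity x σ k xor xorSum (allSubsets n) (λ _ → false)
    ≡⟨ cong₂ _xor_ (intervalParity-binomial x σ k) (xorSum-false (allSubsets n)) ⟩
  (⌊ x ⊆? σ ⌋ ∧ oddBinomial d k) xor false
    ≡⟨ xor-identityʳ _ ⟩
  ⌊ x ⊆? σ ⌋ ∧ oddBinomial d k
    ≡⟨ cong (_∧ oddBinomial d k) (sym (⊆?-inside x σ)) ⟩
  ⌊ (inside ∷ x) ⊆? (inside ∷ σ) ⌋ ∧ oddBinomial d k ∎
  where d = ∣ σ ─ x ∣

intervalParity-codim₂ : ∀ {n} (x σ : Subset n) → (2 + ∣ x ∣ ≡ᵇ ∣ σ ∣) ∧ intervalParity x σ 1 ≡ false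
intervalParity-codim₂ x σ with x ⊆? σ | intervalParity-binomial x σ 1
... | no  _   | parity≡false = trans (cong ((2 + ∣ x ∣ ≡ᵇ ∣ σ ∣) ∧_) parity≡false) (∧-zeroʳ _)
... | yes x⊆σ | parity≡odd   =
  trans (cong₂ _∧_ (cong (2 + ∣ x ∣ ≡ᵇ_) (∣p∣≡∣p─q∣+∣q∣ x⊆σ)) parity≡odd) (two-choose-one-even ∣ σ ─ x ∣)
  where
  two-choose-one-even : ∀ d → (2 + ∣ x ∣ ≡ᵇ d + ∣ x ∣) ∧ oddBinomial d 1 ≡ false
  two-choose-one-even d with d ≟ 2
  ... | yes refl = ∧-zeroʳ _
  ... | no  d≢2  = cong (_∧ oddBinomial d 1) (≡ᵇ-false (d≢2 ∘ sym ∘ +-cancelʳ-≡ ∣ x ∣ 2 d))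

module Boundary {n : ℕ} (K : List (Subset n)) (K-complex : IsComplex K) where
  open DecMembership (_≟ₛ_ {n}) using (_∈?_)

  ∂-face : ∀ {σ τ} → σ ∈ K → σ ⊆ τ → suc ∣ σ ∣ ≡ ∣ τ ∣ → ∂ K τ σ ≡ true
  ∂-face {σ} {τ} σ∈K σ⊆τ size =
    cong₂ _∧_ (⌊⌋-true (σ ∈? K) σ∈K)
              (cong₂ _∧_ (⌊⌋-true (σ ⊆? τ) σ⊆τ) (dec-true (suc ∣ σ ∣ ≟ ∣ τ ∣) size))

  ∂-face⁻ : ∀ {τ y} → ∂ K τ y ≡ true → y ∈ K × y ⊆ τ × suc ∣ y ∣ ≡ ∣ τ ∣
  ∂-face⁻ {τ} {y} ∂τy with y ∈? K | y ⊆? τ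
  ... | yes y∈K | yes y⊆τ = y∈K , y⊆τ , ≡ᵇ⇒≡ (suc ∣ y ∣) ∣ τ ∣ (Equivalence.from T-≡ ∂τy)
  ... | yes _   | no  _   = contradiction ∂τy λ ()
  ... | no  _   | _       = contradiction ∂τy λ ()

  ∂ᶜ-support : ∀ c y → ∂ᶜ K c y ≡ true → y ∈ K
  ∂ᶜ-support c y ∂cy = decidable-stable (y ∈? K) λ y∉K →
    contradiction (trans (sym ∂cy) (ext-vanishes (∂ K) c y λ σ _ → cong (_∧ _) (⌊⌋-false (y ∈? K) y∉K)))
                  λ ()

  ∂∂-summand : ∀ {σ} → σ ∈ K → ∀ x τ →
    ∂ K σ τ ∧ ∂ K τ x ≡ (⌊ x ∈? K ⌋ ∧ (2 + ∣ x ∣ ≡ᵇ ∣ σ ∣)) ∧ inInterval x σ 1 τ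
  ∂∂-summand {σ} σ∈K x τ with x ∈? K | x ⊆? τ | τ ⊆? σ
  ... | no  _   | _       | _       = ∧-zeroʳ _
  ... | yes _   | no  _   | _       = trans (∧-zeroʳ _) (sym (∧-zeroʳ _))
  ... | yes _   | yes _   | no  _   = trans (cong (_∧ _) (∧-zeroʳ ⌊ τ ∈? K ⌋)) (sym (∧-zeroʳ _))
  ... | yes x∈K | yes x⊆τ | yes τ⊆σ =
    trans (cong (λ b → (b ∧ (suc ∣ τ ∣ ≡ᵇ ∣ σ ∣)) ∧ (suc ∣ x ∣ ≡ᵇ ∣ τ ∣)) (⌊⌋-true (τ ∈? K) τ∈K))
          (≡ᵇ-subst (λ m → suc m ≡ᵇ ∣ σ ∣) (suc ∣ x ∣) ∣ τ ∣)
    where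
    τ∈K : τ ∈ K
    τ∈K with IsComplex.nonempty K-complex x∈K
    ... | i , i∈x = IsComplex.closed K-complex σ∈K (i , x⊆τ i∈x) τ⊆σ

  ∂∂≗0 : ∀ {σ} → σ ∈ K → ∂ᶜ K (∂ K σ) ≗ᶜ 0ᶜ
  ∂∂≗0 {σ} σ∈K x = begin
    ∂ᶜ K (∂ K σ) x
      ≡⟨ xorSum-cong (allSubsets n) (∂∂-summand σ∈K x) ⟩
    xorSum (allSubsets n) (λ τ → (x∈ᵇK ∧ (2 + ∣ x ∣ ≡ᵇ ∣ σ ∣)) ∧ inInterval x σ 1 τ)
      ≡⟨ sym (xorSum-∧ˡ (allSubsets n) (x∈ᵇK ∧ (2 + ∣ x ∣ ≡ᵇ ∣ σ ∣)) (inInterval x σ 1)) ⟩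
    (x∈ᵇK ∧ (2 + ∣ x ∣ ≡ᵇ ∣ σ ∣)) ∧ intervalParity x σ 1
      ≡⟨ ∧-assoc x∈ᵇK (2 + ∣ x ∣ ≡ᵇ ∣ σ ∣) (intervalParity x σ 1) ⟩
    x∈ᵇK ∧ ((2 + ∣ x ∣ ≡ᵇ ∣ σ ∣) ∧ intervalParity x σ 1)
      ≡⟨ cong (x∈ᵇK ∧_) (intervalParity-codim₂ x σ) ⟩
    x∈ᵇK ∧ false
      ≡⟨ ∧-zeroʳ x∈ᵇK ⟩
    false ∎
    where x∈ᵇK = ⌊ x ∈? K ⌋

  ∂ᶜ∂ᶜ≗0 : ∀ c → (∀ σ → c σ ≡ true → σ ∈ K) → ∂ᶜ K (∂ᶜ K c) ≗ᶜ 0ᶜ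
  ∂ᶜ∂ᶜ≗0 c c⊆K x =
    trans (ext-ext (∂ K) (∂ K) c x) (ext-vanishes (λ σ → ∂ᶜ K (∂ K σ)) c x λ σ cσ → ∂∂≗0 (c⊆K σ cσ) x)

module MorseReference {n : ℕ} (K : List (Subset n)) (K-complex : IsComplex K) (W : List (Step n))
                      (Υ : Subset n → Chain n) (reference : IsMorseReference K W Υ) where
  open IsMorseReference reference
  open Boundary K K-complex

  ChainMapAt : Subset n → Set
  ChainMapAt σ = dᶜ K Υ (Υ σ) ≗ᶜ ext Υ (∂ K σ)

  ChainMapOn : List (Subset n) → Set
  ChainMapOn L = ∀ {σ} → σ ∈ L → ChainMapAt σ

  chainMap-ext : ∀ c → (∀ σ → c σ ≡ true → ChainMapAt σ) → dᶜ K Υ (ext Υ c) ≗ᶜ ext Υ (∂ᶜ K c)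
  chainMap-ext c chainMap-c x = begin
    ext Υ (∂ᶜ K (ext Υ c)) x
      ≡⟨ ext-cong Υ (ext-ext (∂ K) Υ c) x ⟩
    ext Υ (ext (λ σ → ∂ᶜ K (Υ σ)) c) x
      ≡⟨ ext-ext Υ (λ σ → ∂ᶜ K (Υ σ)) c x ⟩
    ext (λ σ → dᶜ K Υ (Υ σ)) c x
      ≡⟨ ext-cong-support (λ σ → dᶜ K Υ (Υ σ)) (λ σ → ext Υ (∂ K σ)) c x (λ σ cσ → chainMap-c σ cσ x) ⟩
    ext (λ σ → ext Υ (∂ K σ)) c x
      ≡⟨ sym (ext-ext Υ (∂ K) c x) ⟩
    ext Υ (∂ᶜ K c) x ∎

  chainMapOn-fill : ∀ L {σ} → Critical W σ → ChainMapOn L → ChainMapOn (L ++ σ ∷ [])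
  chainMapOn-fill L {σ} critical-σ chainMap-L σ'∈ with ∈-++⁻ L σ'∈
  ... | inj₁ σ'∈L       = chainMap-L σ'∈L
  ... | inj₂ (here refl) = λ x →
    trans (ext-cong Υ (ext-cong (∂ K) (critical σ critical-σ)) x) (ext-cong Υ (ext-⟦⟧ (∂ K) σ) x)

  module Expansion (L : List (Subset n)) {σ τ} (regular : RegularPair W σ τ)
                   (L+στ-complex : IsComplex (L ++ σ ∷ τ ∷ []))
                   (free : IsFreePair (L ++ σ ∷ τ ∷ []) σ τ)
                   (L+στ⊆K : L ++ σ ∷ τ ∷ [] List.⊆ K) where
    open IsFreePair free using (σ∈K; τ∈K; dimσ; dimτ; σ⊊τ)

    ∂τ∖σ≗σ+∂τ : ∂without K τ σ ≗ᶜ (λ y → ⟦ σ ⟧ y xor ∂ K τ y)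
    ∂τ∖σ≗σ+∂τ = delete≗⟦⟧-xor (∂ K τ) σ (∂-face (L+στ⊆K σ∈K) (proj₁ σ⊊τ) (trans (cong suc dimσ) (sym dimτ)))

    ∂τ∖σ⊆L : ∀ y → ∂without K τ σ y ≡ true → y ∈ L
    ∂τ∖σ⊆L y ∂τ∖σ-y with ∂ K τ y in ∂τy | y ≟ₛ σ
    ... | false | _      = contradiction ∂τ∖σ-y λ ()
    ... | true  | yes _  = contradiction ∂τ∖σ-y λ ()
    ... | true  | no y≢σ with ∂-face⁻ ∂τy
    ...   | y∈K , y⊆τ , size
          with ∈-++⁻ L (IsComplex.closed L+στ-complex τ∈K (IsComplex.nonempty K-complex y∈K) y⊆τ)
    ...     | inj₁ y∈L                 = y∈L
    ...     | inj₂ (here y≡σ)          = contradiction y≡σ y≢σ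
    ...     | inj₂ (there (here refl)) = contradiction (sym size) (<⇒≢ (n<1+n ∣ τ ∣))

    Υ∂τ≗0 : ext Υ (∂ K τ) ≗ᶜ 0ᶜ
    Υ∂τ≗0 x = identityʳ-unique (Υ σ x) (ext Υ (∂ K τ) x) (sym (begin
      Υ σ x                                ≡⟨ regularσ σ τ regular x ⟩
      ext Υ (∂without K τ σ) x             ≡⟨ ext-cong Υ ∂τ∖σ≗σ+∂τ x ⟩
      ext Υ (λ y → ⟦ σ ⟧ y xor ∂ K τ y) x  ≡⟨ ext-xor Υ ⟦ σ ⟧ (∂ K τ) x ⟩
      ext Υ ⟦ σ ⟧ x xor ext Υ (∂ K τ) x    ≡⟨ cong (_xor ext Υ (∂ K τ) x) (ext-⟦⟧ Υ σ x) ⟩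
      Υ σ x xor ext Υ (∂ K τ) x            ∎))

    chainMapAt-τ : ChainMapAt τ
    chainMapAt-τ x = begin
      dᶜ K Υ (Υ τ) x      ≡⟨ ext-cong Υ (ext-cong (∂ K) (regularτ σ τ regular)) x ⟩
      ext Υ (∂ᶜ K 0ᶜ) x   ≡⟨ ext-cong Υ (ext-0ᶜ (∂ K)) x ⟩
      ext Υ 0ᶜ x          ≡⟨ ext-0ᶜ Υ x ⟩
      false               ≡⟨ sym (Υ∂τ≗0 x) ⟩
      ext Υ (∂ K τ) x     ∎

    ∂[∂τ∖σ]≗∂σ : ∂ᶜ K (∂without K τ σ) ≗ᶜ ∂ K σ
    ∂[∂τ∖σ]≗∂σ y = begin
      ∂ᶜ K (∂without K τ σ) y               ≡⟨ ext-cong (∂ K) ∂τ∖σ≗σ+∂τ y ⟩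
      ∂ᶜ K (λ z → ⟦ σ ⟧ z xor ∂ K τ z) y    ≡⟨ ext-xor (∂ K) ⟦ σ ⟧ (∂ K τ) y ⟩
      ∂ᶜ K ⟦ σ ⟧ y xor ∂ᶜ K (∂ K τ) y       ≡⟨ cong₂ _xor_ (ext-⟦⟧ (∂ K) σ y) (∂∂≗0 (L+στ⊆K τ∈K) y) ⟩
      ∂ K σ y xor false                     ≡⟨ xor-identityʳ (∂ K σ y) ⟩
      ∂ K σ y                               ∎

    chainMapAt-σ : ChainMapOn L → ChainMapAt σ
    chainMapAt-σ chainMap-L x = begin
      dᶜ K Υ (Υ σ) x
        ≡⟨ ext-cong Υ (ext-cong (∂ K) (regularσ σ τ regular)) x ⟩
      dᶜ K Υ (ext Υ (∂without K τ σ)) x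
        ≡⟨ chainMap-ext (∂without K τ σ) (λ y → chainMap-L ∘ ∂τ∖σ⊆L y) x ⟩
      ext Υ (∂ᶜ K (∂without K τ σ)) x
        ≡⟨ ext-cong Υ ∂[∂τ∖σ]≗∂σ x ⟩
      ext Υ (∂ K σ) x ∎

    chainMapOn-expand : ChainMapOn L → ChainMapOn (L ++ σ ∷ τ ∷ [])
    chainMapOn-expand chainMap-L σ'∈ with ∈-++⁻ L σ'∈
    ... | inj₁ σ'∈L               = chainMap-L σ'∈L
    ... | inj₂ (here refl)         = chainMapAt-σ chainMap-L
    ... | inj₂ (there (here refl)) = chainMapAt-τ

  chainMapOn-step : ∀ L s → s ∈ W → ValidStep L s → L ++ added s List.⊆ K →
                    ChainMapOn L → ChainMapOn (L ++ added s)
  chainMapOn-step L (fill σ)     s∈W _                    _  = chainMapOn-fill L s∈W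
  chainMapOn-step L (expand σ τ) s∈W (complex , free , _) ⊆K =
    Expansion.chainMapOn-expand L s∈W complex free ⊆K

  chainMapOn-final : ∀ L Ws → Ws List.⊆ W → L ++ final Ws List.⊆ K → ValidFrom L Ws →
                     ChainMapOn L → ChainMapOn (L ++ final Ws)
  chainMapOn-final L []       _    _  _                chainMap-L =
    subst ChainMapOn (sym (++-identityʳ L)) chainMap-L
  chainMapOn-final L (s ∷ Ws) Ws⊆W ⊆K (valid , valids) chainMap-L =
    subst ChainMapOn (++-assoc L (added s) (final Ws))
      (chainMapOn-final (L ++ added s) Ws (Ws⊆W ∘ there) L+s+Ws⊆K valids
        (chainMapOn-step L s (Ws⊆W (here refl)) valid (L+s+Ws⊆K ∘ xs⊆xs++ys (L ++ added s) (final Ws))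
          chainMap-L))
    where
    L+s+Ws⊆K : (L ++ added s) ++ final Ws List.⊆ K
    L+s+Ws⊆K = ⊆K ∘ ⊆-reflexive (++-assoc L (added s) (final Ws))

  chainMapOn-K : IsMorseSequence K W → ChainMapOn K
  chainMapOn-K (valid , K≈final) σ∈K =
    chainMapOn-final [] W (λ s∈W → s∈W) (Equivalence.from (K≈final _)) valid (λ ())
      (Equivalence.to (K≈final _) σ∈K)

proposition3 : (n : ℕ) (K : List (Subset n)) → IsComplex K →
    (W : List (Step n)) → IsMorseSequence K W →
    (Υ : Subset n → Chain n) → IsMorseReference K W Υ →
    (p : ℕ) (c : Chain n) → IsCriticalChain W (suc p) c →
    ∀ x → dᶜ K Υ (dᶜ K Υ c) x ≡ false
proposition3 n K K-complex W morse Υ reference _ c c-critical x = begin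
  dᶜ K Υ (dᶜ K Υ c) x       ≡⟨ chainMap-ext (∂ᶜ K c) (λ y → chainMapOn-K morse ∘ ∂ᶜ-support c y) x ⟩
  ext Υ (∂ᶜ K (∂ᶜ K c)) x   ≡⟨ ext-cong Υ (∂ᶜ∂ᶜ≗0 c c⊆K) x ⟩
  ext Υ 0ᶜ x                ≡⟨ ext-0ᶜ Υ x ⟩
  false                     ∎
  where
  open MorseReference K K-complex W Υ reference
  open Boundary K K-complex
  c⊆K : ∀ σ → c σ ≡ true → σ ∈ K
  c⊆K σ cσ =
    Equivalence.from (proj₂ morse σ) (∈-concatMap⁺ added (lose (proj₁ (c-critical σ cσ)) (here refl)))
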